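{- There exists a family of unweighted graphs under stochastic rewards and adversarial arrivals for which SimpleGreedy achieves a competitive ratio of at most $1/2$, even when all edges have uniform probability $p = O(1/n)$.
   Context: Setting: online bipartite matching with stochastic rewards. There is a bipartite graph with a set $U$ of offline vertices (known in advance) and a set $V$ of online vertices, which arrive one at a time in an order chosen by an adversary. Each edge $(u,v)$ exists independently with a known probability $p_{u,v}$, whose existence is only revealed when it is probed. In the probe-commit model, if a probed edge exists, it must be irrevocably added to the matching. In the stochastic rewards setting, each online vertex has patience $1$: when $v$ arrives, at most one incident edge $(u,v)$ to a still-unmatched offline vertex $u$ may be probed, after which $v$ departs. The graph is unweighted, so each successful match earns reward $1$. An opportunistic algorithm always probes an edge incident to an arriving online vertex $v$ if one to an unmatched offline neighbor exists. SimpleGreedy is the opportunistic algorithm that, when $v\in V$ arrives, chooses an unmatched neighbor $u\in U$ of $v$ arbitrarily (ties can be broken adversarially) and probes $(u,v)$. The competitive ratio compares the algorithm's expected matching size to that of an optimal offline (adaptive) probing algorithm, in the worst case over graphs and arrival orders. It is known (Mehta and Panigrahi 2012) that any opportunistic algorithm, including SimpleGreedy, is at least $1/2$-competitive in this setting. -}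

module Defs where

open import Data.Bool using (Bool; true; false; _∧_; not; if_then_else_)
open import Data.Nat using (ℕ; zero; suc)
open import Data.Fin using (Fin)
open import Data.List using (List; []; _∷_; filter; foldr; map; concatMap)
open import Data.List.Membership.Propositional using (_∈_)
open import Data.Vec using (Vec; lookup; replicate; _[_]≔_)
open import Data.Fin.Base using () renaming (toℕ to toℕ)
open import Data.List using (allFin)
open import Data.Integer using (+_)
open import Data.Rational using (ℚ; 0ℚ; 1ℚ; _+_; _*_; _-_; _⊔_; _/_)
open import Relation.Nullary.Decidable using (does)
open import Relation.Binary.PropositionalEquality using (_≡_)
open import Data.Bool.Properties using () renaming (_≟_ to _≟B_)
open import Data.Product using (Σ; _×_)

-- An unweighted bipartite instance: offline vertices Fin nU, online vertices Fin nV
-- (arriving in the order 0,1,...,nV-1, which the adversary fixes by choosing the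
-- labelling), edge set E, and a uniform edge probability p.
record Instance : Set where
  field
    nU nV : ℕ
    E     : Fin nV → Fin nU → Bool
    p     : ℚ

Matched : ℕ → Set
Matched n = Vec Bool n

module _ (I : Instance) where
  open Instance I

  freeNbrs : Fin nV → Matched nU → List (Fin nU)
  freeNbrs v M = filter (λ u → E v u ∧ not (lookup M u) ≟B true) (allFin nU)

  -- An (adversarial) tie-breaking rule for SimpleGreedy: when v arrives and M is
  -- the set of matched offline vertices, it names the neighbour to probe; it must
  -- name an unmatched neighbour of v whenever one exists.
  record TieBreak : Set where
    field
      choose : Fin nV → Matched nU → Fin nU
      valid  : ∀ v M u → u ∈ freeNbrs v M → choose v M ∈ freeNbrs v M

  -- one probe of an edge to u: succeeds w.p. p (u becomes matched, reward 1)
  probeValue : (succ fail : ℚ) → ℚ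
  probeValue succ fail = p * (1ℚ + succ) + (1ℚ - p) * fail

  -- expected size of the matching produced by SimpleGreedy with tie-breaking T,
  -- processing the remaining arrivals in list order, from matched set M
  greedyFrom : TieBreak → List (Fin nV) → Matched nU → ℚ
  greedyFrom T []       M = 0ℚ
  greedyFrom T (v ∷ vs) M with freeNbrs v M
  ... | []    = greedyFrom T vs M
  ... | _ ∷ _ = probeValue (greedyFrom T vs (M [ u ]≔ true)) (greedyFrom T vs M)
    where u = TieBreak.choose T v M

  greedyValue : TieBreak → ℚ
  greedyValue T = greedyFrom T (allFin nV) (replicate nU false)

  -- maximum of a list of rationals together with 0 (0 = stop probing)
  max0 : List ℚ → ℚ
  max0 = foldr _⊔_ 0ℚ

  -- optimal offline adaptive probing value (probe-commit, patience 1 per online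
  -- vertex): from matched offline set M and used online set W, choose any unused
  -- online v and unmatched offline u with (u,v) ∈ E to probe, or stop.  The fuel
  -- k bounds the number of further probes; k = nV suffices since each probe uses
  -- up one online vertex.
  optFrom : ℕ → Matched nU → Vec Bool nV → ℚ
  optFrom zero    M W = 0ℚ
  optFrom (suc k) M W =
    max0 (concatMap (λ v →
            if lookup W v then []
            else map (λ u → probeValue (optFrom k (M [ u ]≔ true) (W [ v ]≔ true))
                                       (optFrom k M (W [ v ]≔ true)))
                     (freeNbrs v M))
          (allFin nV))

  optValue : ℚ
  optValue = optFrom nV (replicate nU false) (replicate nV false)

ℕtoℚ : ℕ → ℚ
ℕtoℚ n = + n / 1

module Submission where

-- Size n: good offline vertices 0..n-1, bad
-- ones n..2n-1; L = n² early online vertices adjacent to all of them, then L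
-- late ones adjacent to the good ones only; edge probability p.  The
-- adversarial tie-break probes the lowest-indexed free vertex, so greedy
-- spends the early arrivals on the good vertices and the late ones find them
-- full, while OPT sends early arrivals to bad and late ones to good vertices.
-- With X ~ Bin(L, p) early successes, greedy gets about E[max(X, n)] and OPT
-- about 2·E[min(X, n)]; both deviations from n are bounded by k + c·E[(n−X)²]
-- through a quadratic majorant y ≤ k + c·y².  This is made exact by potentials
-- (free slots ± that error term) that are exact probe-averages, so induction
-- over the arrivals bounds greedy above and a fixed OPT policy below.

open import Defs
open import Data.Nat as ℕ using (ℕ; zero; suc; _≥_; z≤n; s≤s; _<ᵇ_)
import Data.Nat.Properties as ℕₚ
open import Data.Integer as ℤ using (ℤ; +[1+_]; -[1+_])
import Data.Integer.Properties as ℤₚ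
import Data.Integer.Solver as ℤSolver
open import Data.Nat.Coprimality using (1-coprimeTo) renaming (sym to coprime-sym)
open import Data.Rational using (ℚ; mkℚ; ↥_; 0ℚ; 1ℚ; ½; _≤_; _<_; _+_; _*_; _-_; -_; 1/_; _⊔_;
  *≤*; toℚᵘ; Positive; positive; nonNegative)
open import Data.Rational.Properties
import Data.Rational.Unnormalised as ℚᵘ
import Data.Rational.Unnormalised.Properties as ℚᵘₚ
open import Data.Rational.Solver using (module +-*-Solver)
open import Data.Bool using (Bool; true; false; _∧_; _∨_; not; T; if_then_else_)
open import Data.Bool.Properties using (∨-zeroʳ) renaming (_≟_ to _≟B_)
open import Data.Fin using (Fin; toℕ; fromℕ<) renaming (zero to fzero; suc to fsuc)
import Data.Fin.Properties as Finₚ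
open import Data.Maybe using (Maybe; just; nothing; fromMaybe)
import Data.Maybe as Maybe
open import Data.List using (List; []; _∷_; foldr; map; concatMap; allFin; tabulate)
open import Data.List.Membership.Propositional using (_∈_)
open import Data.List.Membership.Propositional.Properties using (∈-filter⁺; ∈-filter⁻; ∈-allFin; ∈-map⁺; ∈-concatMap⁺)
open import Data.List.Relation.Unary.Any using (here; there)
import Data.List.Relation.Unary.Any as Any
open import Data.Vec using (Vec; []; _∷_; lookup; replicate; _[_]≔_)
open import Data.Vec.Properties using (lookup∘update; lookup∘update′; lookup-replicate)
open import Data.Product using (Σ; _×_; _,_; proj₁; proj₂)
open import Data.Sum using (inj₁; inj₂)
open import Data.Empty using (⊥-elim)
open import Data.Unit using (tt)
open import Relation.Nullary using (¬_; yes; no)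
open import Relation.Binary.PropositionalEquality

≤-fromGap : ∀ {a b} t → b ≡ a + t → 0ℚ ≤ t → a ≤ b
≤-fromGap {a} {b} t b≡a+t 0≤t =
  subst (_≤ b) (+-identityʳ a) (subst (a + 0ℚ ≤_) (sym b≡a+t) (+-monoʳ-≤ a 0≤t))

≤⇒0≤- : ∀ {a b} → a ≤ b → 0ℚ ≤ b - a
≤⇒0≤- {a} {b} a≤b = subst (_≤ b - a) (+-inverseʳ a) (+-monoˡ-≤ (- a) a≤b)

≤⇒-≤0 : ∀ {a b} → a ≤ b → a - b ≤ 0ℚ
≤⇒-≤0 {a} {b} a≤b = subst (a - b ≤_) (+-inverseʳ b) (+-monoˡ-≤ (- b) a≤b)

0≤-⇒≤ : ∀ {a b} → 0ℚ ≤ b - a → a ≤ b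
0≤-⇒≤ {a} {b} = ≤-fromGap (b - a) (solve 2 (λ a b → b := a :+ (b :- a)) refl a b)
  where open +-*-Solver

0≤* : ∀ {a b} → 0ℚ ≤ a → 0ℚ ≤ b → 0ℚ ≤ a * b
0≤* {a} {b} 0≤a 0≤b = nonNegative⁻¹ (a * b) {{nonNeg*nonNeg⇒nonNeg a {{nonNegative 0≤a}} b {{nonNegative 0≤b}}}}

0≤+ : ∀ {a b} → 0ℚ ≤ a → 0ℚ ≤ b → 0ℚ ≤ a + b
0≤+ {a} {b} 0≤a 0≤b = subst (_≤ a + b) (+-identityʳ 0ℚ) (+-mono-≤ 0≤a 0≤b)

0≤1 : 0ℚ ≤ 1ℚ
0≤1 = nonNegative⁻¹ 1ℚ

0≤½ : 0ℚ ≤ ½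
0≤½ = <⇒≤ (positive⁻¹ ½)

0≤square : ∀ z → 0ℚ ≤ z * z
0≤square z with ≤-total 0ℚ z
... | inj₁ 0≤z = 0≤* 0≤z 0≤z
... | inj₂ z≤0 = subst (0ℚ ≤_) (neg*neg≡* z) (0≤* (neg-antimono-≤ z≤0) (neg-antimono-≤ z≤0))
  where
    open +-*-Solver
    neg*neg≡* : ∀ z → (- z) * (- z) ≡ z * z
    neg*neg≡* = solve 1 (λ z → (:- z) :* (:- z) := z :* z) refl

⌜_⌝ : ℕ → ℚ
⌜ zero ⌝  = 0ℚ
⌜ suc n ⌝ = 1ℚ + ⌜ n ⌝

⌜⌝-nonneg : ∀ n → 0ℚ ≤ ⌜ n ⌝
⌜⌝-nonneg zero    = ≤-refl
⌜⌝-nonneg (suc n) = 0≤+ 0≤1 (⌜⌝-nonneg n)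

⌜⌝-+ : ∀ a b → ⌜ a ℕ.+ b ⌝ ≡ ⌜ a ⌝ + ⌜ b ⌝
⌜⌝-+ zero    b = sym (+-identityˡ ⌜ b ⌝)
⌜⌝-+ (suc a) b = trans (cong (1ℚ +_) (⌜⌝-+ a b)) (sym (+-assoc 1ℚ ⌜ a ⌝ ⌜ b ⌝))

⌜⌝-* : ∀ a b → ⌜ a ℕ.* b ⌝ ≡ ⌜ a ⌝ * ⌜ b ⌝
⌜⌝-* zero    b = sym (*-zeroˡ ⌜ b ⌝)
⌜⌝-* (suc a) b = begin
  ⌜ b ℕ.+ a ℕ.* b ⌝       ≡⟨ ⌜⌝-+ b (a ℕ.* b) ⟩
  ⌜ b ⌝ + ⌜ a ℕ.* b ⌝     ≡⟨ cong (⌜ b ⌝ +_) (⌜⌝-* a b) ⟩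
  ⌜ b ⌝ + ⌜ a ⌝ * ⌜ b ⌝   ≡⟨ solve 2 (λ x y → y :+ x :* y := (con 1ℚ :+ x) :* y) refl ⌜ a ⌝ ⌜ b ⌝ ⟩
  (1ℚ + ⌜ a ⌝) * ⌜ b ⌝    ∎
  where open ≡-Reasoning
        open +-*-Solver

⌜⌝-mono : ∀ {a b} → a ℕ.≤ b → ⌜ a ⌝ ≤ ⌜ b ⌝
⌜⌝-mono {a} {b} a≤b =
  ≤-fromGap ⌜ b ℕ.∸ a ⌝ (trans (cong ⌜_⌝ (sym (ℕₚ.m+[n∸m]≡n a≤b))) (⌜⌝-+ a (b ℕ.∸ a))) (⌜⌝-nonneg (b ℕ.∸ a))

ℕtoℚ≡n/1 : ∀ n → ℕtoℚ n ≡ mkℚ (ℤ.+ n) 0 (coprime-sym (1-coprimeTo n))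
ℕtoℚ≡n/1 n = normalize-coprime (coprime-sym (1-coprimeTo n))

ℕtoℚ-suc : ∀ n → ℕtoℚ (suc n) ≡ 1ℚ + ℕtoℚ n
ℕtoℚ-suc n = begin
  ℕtoℚ (suc n)   ≡⟨ ℕtoℚ≡n/1 (suc n) ⟩
  n/1 (suc n)    ≡⟨ toℚᵘ-injective (ℚᵘₚ.≃-trans (ℚᵘ.*≡* (cross-multiplied (ℤ.+ n))) (ℚᵘₚ.≃-sym (toℚᵘ-homo-+ 1ℚ (n/1 n)))) ⟩
  1ℚ + n/1 n    ≡⟨ cong (1ℚ +_) (sym (ℕtoℚ≡n/1 n)) ⟩
  1ℚ + ℕtoℚ n    ∎
  where
    open ≡-Reasoning
    n/1 : ℕ → ℚ
    n/1 m = mkℚ (ℤ.+ m) 0 (coprime-sym (1-coprimeTo m))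
    -- the cross-multiplied form of (1 + n)/1 ≃ 1/1 + n/1 in unnormalised ℚ
    cross-multiplied : ∀ (x : ℤ) → (ℤ.+ 1 ℤ.+ x) ℤ.* (ℤ.+ 1) ≡ ((ℤ.+ 1) ℤ.* (ℤ.+ 1) ℤ.+ x ℤ.* (ℤ.+ 1)) ℤ.* (ℤ.+ 1)
    cross-multiplied = solve 1 (λ x → (con (ℤ.+ 1) :+ x) :* con (ℤ.+ 1) := (con (ℤ.+ 1) :* con (ℤ.+ 1) :+ x :* con (ℤ.+ 1)) :* con (ℤ.+ 1)) refl
      where open ℤSolver.+-*-Solver

ℕtoℚ≡⌜⌝ : ∀ n → ℕtoℚ n ≡ ⌜ n ⌝
ℕtoℚ≡⌜⌝ zero    = refl
ℕtoℚ≡⌜⌝ (suc n) = trans (ℕtoℚ-suc n) (cong (1ℚ +_) (ℕtoℚ≡⌜⌝ n))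

≤numerator : ∀ (r : ℚ) N → ↥ r ≡ ℤ.+ N → r ≤ ⌜ N ⌝
≤numerator (mkℚ n e c) N refl = subst (mkℚ (ℤ.+ N) e c ≤_) (trans (sym (ℕtoℚ≡n/1 N)) (ℕtoℚ≡⌜⌝ N))
  (*≤* (ℤₚ.*-monoˡ-≤-nonNeg (ℤ.+ N) (ℤ.+≤+ (s≤s z≤n))))

-- Archimedean property: every positive ε has a multiple ε·a ≥ 1 (take a
-- to be the numerator of 1/ε).
archimedean : ∀ ε → 0ℚ < ε → Σ ℕ λ a → 1ℚ ≤ ε * ⌜ a ⌝
archimedean ε@(mkℚ +[1+ e ] d _) 0<ε = suc d ,
  subst (_≤ ε * ⌜ suc d ⌝) (*-inverseʳ ε) (*-monoˡ-≤-nonNeg ε {{nonNegative (<⇒≤ 0<ε)}} (≤numerator (1/ ε) (suc d) refl))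
archimedean (mkℚ (ℤ.+ zero) d c) 0<ε with () ← positive 0<ε
archimedean (mkℚ -[1+ e ] d c) 0<ε with () ← positive 0<ε

-- Potentials.  The formulas are written once over an arbitrary signature
-- (1, +, ·, −) so that the same expressions can be evaluated in ℚ and handed
-- to the ring solver as polynomials.
module Shapes {A : Set} (one : A) (_⊕_ _⊗_ _⊖_ : A → A → A) where

  -- value of probing an edge of probability p: success gains 1 and leads to
  -- value `succ`, failure leads to value `fail` (this is Defs.probeValue)
  probeAvg : (p succ fail : A) → A
  probeAvg p succ fail = (p ⊗ (one ⊕ succ)) ⊕ ((one ⊖ p) ⊗ fail)

  -- E[(d − X)²] for X ~ Bin(R, p): squared bias plus variance
  secondMoment : (p R d : A) → A
  secondMoment p R d = ((d ⊖ (R ⊗ p)) ⊗ (d ⊖ (R ⊗ p))) ⊕ ((R ⊗ p) ⊗ (one ⊖ p))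

  -- k + c·E[(d − X)²]: dominates E[(X − d)⁺] and E[(d − X)⁺] when y ≤ k + c·y²
  errorTerm : (p k c R d : A) → A
  errorTerm p k c R d = k ⊕ (c ⊗ secondMoment p R d)

  -- with N slots of which s are filled and R further probes of probability p
  -- to come: an upper and a lower potential for the number of further matches
  upperPot lowerPot : (p k c N s R : A) → A
  upperPot p k c N s R = (N ⊖ s) ⊕ errorTerm p k c R (N ⊖ s)
  lowerPot p k c N s R = (N ⊖ s) ⊖ errorTerm p k c R (N ⊖ s)

  -- change of either potential when R grows by one; nonnegative once s ≥ N
  drift : (p c N s R : A) → A
  drift p c N s R = c ⊗ (p ⊗ ((((one ⊕ (s ⊖ N)) ⊕ (s ⊖ N)) ⊕ (R ⊗ p)) ⊕ (R ⊗ p)))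

open Shapes 1ℚ _+_ _*_ _-_

module PotentialIdentities where
  open +-*-Solver
  private
    module P {m : ℕ} = Shapes {Polynomial m} (con 1ℚ) _:+_ _:*_ _:-_
    one : ∀ {m} → Polynomial m
    one = con 1ℚ

  probeAvg-shift : ∀ p a b z → probeAvg p (a + z) (b + z) ≡ probeAvg p a b + z
  probeAvg-shift = solve 4 (λ p a b z → P.probeAvg p (a :+ z) (b :+ z) := P.probeAvg p a b :+ z) refl

  upperPot-harmonic : ∀ p k c N s R →
    probeAvg p (upperPot p k c N (1ℚ + s) R) (upperPot p k c N s R) ≡ upperPot p k c N s (1ℚ + R)
  upperPot-harmonic = solve 6 (λ p k c N s R →
    P.probeAvg p (P.upperPot p k c N (one :+ s) R) (P.upperPot p k c N s R) := P.upperPot p k c N s (one :+ R)) refl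

  lowerPot-harmonic : ∀ p k c N s R →
    probeAvg p (lowerPot p k c N (1ℚ + s) R) (lowerPot p k c N s R) ≡ lowerPot p k c N s (1ℚ + R)
  lowerPot-harmonic = solve 6 (λ p k c N s R →
    P.probeAvg p (P.lowerPot p k c N (one :+ s) R) (P.lowerPot p k c N s R) := P.lowerPot p k c N s (one :+ R)) refl

  upperPot-drift : ∀ p k c N s R → upperPot p k c N s (1ℚ + R) ≡ upperPot p k c N s R + drift p c N s R
  upperPot-drift = solve 6 (λ p k c N s R → P.upperPot p k c N s (one :+ R) := P.upperPot p k c N s R :+ P.drift p c N s R) refl

  lowerPot-drift : ∀ p k c N s R → lowerPot p k c N s R ≡ lowerPot p k c N s (1ℚ + R) + drift p c N s R
  lowerPot-drift = solve 6 (λ p k c N s R → P.lowerPot p k c N s R := P.lowerPot p k c N s (one :+ R) :+ P.drift p c N s R) refl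

  upperPot-settle : ∀ p k c N s → upperPot p k c N s 0ℚ ≡
    probeAvg p (upperPot p k c N (1ℚ + s) 0ℚ) (upperPot p k c N s 0ℚ) + c * (p * ((N - (1ℚ + s)) + (N - s)))
  upperPot-settle = solve 5 (λ p k c N s → P.upperPot p k c N s (con 0ℚ) :=
    P.probeAvg p (P.upperPot p k c N (one :+ s) (con 0ℚ)) (P.upperPot p k c N s (con 0ℚ)) :+ c :* (p :* ((N :- (one :+ s)) :+ (N :- s)))) refl

  errorTerm-noProbes : ∀ p k c d → errorTerm p k c 0ℚ d ≡ k + c * (d * d)
  errorTerm-noProbes = solve 4 (λ p k c d → P.errorTerm p k c (con 0ℚ) d := k :+ c :* (d :* d)) refl

  -- d + errorTerm split as (majorant gap at Rp − d) + (nonnegative rest)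
  errorTerm-split : ∀ p k c R d → d + errorTerm p k c R d ≡
    ((k + c * ((R * p - d) * (R * p - d))) - (R * p - d)) + (R * p + c * ((R * p) * (1ℚ - p)))
  errorTerm-split = solve 5 (λ p k c R d → d :+ P.errorTerm p k c R d :=
    ((k :+ c :* ((R :* p :- d) :* (R :* p :- d))) :- (R :* p :- d)) :+ (R :* p :+ c :* ((R :* p) :* (one :- p)))) refl

open PotentialIdentities

probeAvg-mono : ∀ {p a a' b b'} → 0ℚ ≤ p → p ≤ 1ℚ → a ≤ a' → b ≤ b' → probeAvg p a b ≤ probeAvg p a' b'
probeAvg-mono {p} 0≤p p≤1 a≤a' b≤b' =
  +-mono-≤ (*-monoˡ-≤-nonNeg p {{nonNegative 0≤p}} (+-monoʳ-≤ 1ℚ a≤a'))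
           (*-monoˡ-≤-nonNeg (1ℚ - p) {{nonNegative (≤⇒0≤- p≤1)}} b≤b')

module MajorantBounds (p k c : ℚ) (0≤p : 0ℚ ≤ p) (p≤1 : p ≤ 1ℚ) (0≤c : 0ℚ ≤ c)
                      (majorant : ∀ y → y ≤ k + c * (y * y)) where

  -- with no probes left the lower potential is ≤ 0
  errorTerm-dominates : ∀ d → d ≤ errorTerm p k c 0ℚ d
  errorTerm-dominates d = subst (d ≤_) (sym (errorTerm-noProbes p k c d)) (majorant d)

  -- the upper potential is ≥ 0
  upperPot-nonneg : ∀ R d → 0ℚ ≤ R → 0ℚ ≤ d + errorTerm p k c R d
  upperPot-nonneg R d 0≤R = subst (0ℚ ≤_) (sym (errorTerm-split p k c R d))
    (0≤+ (≤⇒0≤- (majorant (R * p - d))) (0≤+ (0≤* 0≤R 0≤p) (0≤* 0≤c (0≤* (0≤* 0≤R 0≤p) (≤⇒0≤- p≤1)))))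

firstFalse : ∀ {m} → Vec Bool m → Maybe (Fin m)
firstFalse []            = nothing
firstFalse (false ∷ _)   = just fzero
firstFalse (true  ∷ bs)  = Maybe.map fsuc (firstFalse bs)

firstFalse-spec : ∀ {m} (bs : Vec Bool m) u → lookup bs u ≡ false →
  Σ (Fin m) λ w → firstFalse bs ≡ just w × lookup bs w ≡ false × toℕ w ℕ.≤ toℕ u
firstFalse-spec (false ∷ bs) u        _  = fzero , refl , refl , z≤n
firstFalse-spec (true ∷ bs)  (fsuc u) bu with firstFalse-spec bs u bu
... | w , found , bw , w≤u = fsuc w , cong (Maybe.map fsuc) found , bw , s≤s w≤u

update-other : ∀ {m} (bs : Vec Bool m) (a i : Fin m) → toℕ a ≢ toℕ i → lookup (bs [ a ]≔ true) i ≡ lookup bs i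
update-other bs a i a≢i = lookup∘update′ (λ eq → a≢i (cong toℕ (sym eq))) bs true

≤max0 : ∀ {x} {xs : List ℚ} → x ∈ xs → x ≤ foldr _⊔_ 0ℚ xs
≤max0 {xs = y ∷ xs} (here refl) = p≤p⊔q y _
≤max0 {xs = y ∷ xs} (there x∈) = ≤-trans (≤max0 x∈) (p≤q⊔p y _)

max0-nonneg : ∀ (xs : List ℚ) → 0ℚ ≤ foldr _⊔_ 0ℚ xs
max0-nonneg []       = ≤-refl
max0-nonneg (y ∷ xs) = ≤-trans (max0-nonneg xs) (p≤q⊔p y _)

<ᵇ-true : ∀ {a b} → a ℕ.< b → (a <ᵇ b) ≡ true
<ᵇ-true {a} {b} a<b with a <ᵇ b | ℕₚ.<⇒<ᵇ a<b
... | true | _ = refl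

<ᵇ-sound : ∀ {a b} → (a <ᵇ b) ≡ true → a ℕ.< b
<ᵇ-sound {a} {b} eq = ℕₚ.<ᵇ⇒< a b (subst T (sym eq) tt)

∧-not-true : ∀ {a b} → (a ∧ not b) ≡ true → a ≡ true × b ≡ false
∧-not-true {true} {false} _ = refl , refl

module HardInstance (n : ℕ) (0<n : 0 ℕ.< n) (p : ℚ) where

  L nV nU : ℕ
  L  = n ℕ.* n
  nV = L ℕ.+ L
  nU = n ℕ.+ n

  E : Fin nV → Fin nU → Bool
  E v u = (toℕ v <ᵇ L) ∨ (toℕ u <ᵇ n)

  I : Instance
  I = record { nU = nU ; nV = nV ; E = E ; p = p }

  early-edge : ∀ {v u} → toℕ v ℕ.< L → E v u ≡ true
  early-edge {v} {u} v<L = cong (_∨ (toℕ u <ᵇ n)) (<ᵇ-true v<L)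

  good-edge : ∀ {v u} → toℕ u ℕ.< n → E v u ≡ true
  good-edge {v} {u} u<n = trans (cong ((toℕ v <ᵇ L) ∨_) (<ᵇ-true u<n)) (∨-zeroʳ _)

  late-edge⇒good : ∀ {v u} → ¬ (toℕ v ℕ.< L) → E v u ≡ true → toℕ u ℕ.< n
  late-edge⇒good {v} {u} v≮L e with toℕ v <ᵇ L in eq
  ... | true  = ⊥-elim (v≮L (<ᵇ-sound eq))
  ... | false = <ᵇ-sound e

  free⇒edge : ∀ {v M u} → u ∈ freeNbrs I v M → E v u ≡ true × lookup M u ≡ false
  free⇒edge {v} {M} u∈ = ∧-not-true (proj₂ (∈-filter⁻ (λ u → E v u ∧ not (lookup M u) ≟B true) {xs = allFin nU} u∈))

  edge⇒free : ∀ {v M u} → E v u ≡ true → lookup M u ≡ false → u ∈ freeNbrs I v M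
  edge⇒free {v} {M} {u} e free = ∈-filter⁺ (λ u → E v u ∧ not (lookup M u) ≟B true) (∈-allFin u)
    (subst₂ (λ a b → (a ∧ not b) ≡ true) (sym e) (sym free) refl)

  -- the offline vertex named when none is free (never actually probed)
  u₀ : Fin nU
  u₀ = fromℕ< (ℕₚ.≤-trans 0<n (ℕₚ.m≤m+n n n))

  lowestFree : Fin nV → Matched nU → Fin nU
  lowestFree _ M = fromMaybe u₀ (firstFalse M)

  -- The lowest free vertex is a neighbour whenever some free vertex is: early
  -- arrivals see everything, and for late ones it lies below a good vertex.
  lowestFree-valid : ∀ v M u → u ∈ freeNbrs I v M → lowestFree v M ∈ freeNbrs I v M
  lowestFree-valid v M u u∈ with free⇒edge {v} {M} u∈
  ... | e , free with firstFalse-spec M u free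
  ... | w , found , freeW , w≤u =
    subst (_∈ freeNbrs I v M) (sym (cong (fromMaybe u₀) found)) (edge⇒free {v} {M} edgeW freeW)
    where
      edgeW : E v w ≡ true
      edgeW with toℕ v ℕ.<? L
      ... | yes v<L = early-edge v<L
      ... | no  v≮L = good-edge (ℕₚ.≤-<-trans w≤u (late-edge⇒good v≮L e))

  lowestFirst : TieBreak I
  lowestFirst = record { choose = lowestFree ; valid = lowestFree-valid }

  Prefix : Matched nU → ℕ → Set
  Prefix M s = (∀ i → toℕ i ℕ.< s → lookup M i ≡ true) × (∀ i → s ℕ.≤ toℕ i → lookup M i ≡ false)

  prefix-free⇒≥ : ∀ {M s i} → Prefix M s → lookup M i ≡ false → s ℕ.≤ toℕ i
  prefix-free⇒≥ {M} {s} {i} (below , _) free with toℕ i ℕ.<? s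
  ... | yes i<s with () ← trans (sym (below i i<s)) free
  ... | no  i≮s = ℕₚ.≮⇒≥ i≮s

  lowestFree-prefix : ∀ {v M s u} → Prefix M s → u ∈ freeNbrs I v M → toℕ (lowestFree v M) ≡ s
  lowestFree-prefix {v} {M} {s} {u} P u∈
    with firstFalse-spec M (fromℕ< s<nU) (proj₂ P _ (ℕₚ.≤-reflexive (sym (Finₚ.toℕ-fromℕ< s<nU))))
    where
      s<nU : s ℕ.< nU
      s<nU = ℕₚ.≤-<-trans (prefix-free⇒≥ {M} P (proj₂ (free⇒edge {v} {M} u∈))) (Finₚ.toℕ<n u)
  ... | w , found , freeW , w≤s = trans (cong (λ z → toℕ (fromMaybe u₀ z)) found)
    (ℕₚ.≤-antisym (subst (toℕ w ℕ.≤_) (Finₚ.toℕ-fromℕ< _) w≤s) (prefix-free⇒≥ {M} P freeW))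

  prefix-extend : ∀ {M s w} → Prefix M s → toℕ w ≡ s → Prefix (M [ w ]≔ true) (suc s)
  prefix-extend {M} {s} {w} (below , above) w≡s = below′ , above′
    where
      below′ : ∀ i → toℕ i ℕ.< suc s → lookup (M [ w ]≔ true) i ≡ true
      below′ i i≤s with i Finₚ.≟ w
      ... | yes refl = lookup∘update i M true
      ... | no  i≢w  = trans (update-other M w i (λ e → i≢w (Finₚ.toℕ-injective (sym e))))
                         (below i (ℕₚ.≤∧≢⇒< (ℕₚ.≤-pred i≤s) (λ e → i≢w (Finₚ.toℕ-injective (trans e (sym w≡s))))))
      above′ : ∀ i → suc s ℕ.≤ toℕ i → lookup (M [ w ]≔ true) i ≡ false
      above′ i s<i = trans (update-other M w i (λ e → ℕₚ.<-irrefl (trans (sym w≡s) e) s<i))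
                           (above i (ℕₚ.≤-trans (ℕₚ.n≤1+n s) s<i))

  early-stuck⇒full : ∀ {v M s} → toℕ v ℕ.< L → freeNbrs I v M ≡ [] → Prefix M s → nU ℕ.≤ s
  early-stuck⇒full {v} {M} {s} v<L none P with s ℕ.<? nU
  ... | no  s≮nU = ℕₚ.≮⇒≥ s≮nU
  ... | yes s<nU with () ← subst (fromℕ< s<nU ∈_) none
        (edge⇒free {v} {M} (early-edge v<L) (proj₂ P _ (ℕₚ.≤-reflexive (sym (Finₚ.toℕ-fromℕ< s<nU)))))

  late-probe⇒s<n : ∀ {v M s u} → ¬ (toℕ v ℕ.< L) → u ∈ freeNbrs I v M → Prefix M s → s ℕ.< n
  late-probe⇒s<n {v} {M} v≮L u∈ P = ℕₚ.≤-<-trans (prefix-free⇒≥ {M} P free) (late-edge⇒good v≮L e)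
    where e = proj₁ (free⇒edge {v} {M} u∈)
          free = proj₂ (free⇒edge {v} {M} u∈)

  data Arrivals : ℕ → List (Fin nV) → Set where
    done : Arrivals nV []
    next : ∀ {j v vs} → toℕ v ≡ j → Arrivals (suc j) vs → Arrivals j (v ∷ vs)

  arrivals-tabulate : ∀ m (f : Fin m → Fin nV) j → (∀ i → toℕ (f i) ≡ j ℕ.+ toℕ i) → j ℕ.+ m ≡ nV →
                      Arrivals j (tabulate f)
  arrivals-tabulate zero f j _ j≡nV = subst (λ z → Arrivals z []) (sym (trans (sym (ℕₚ.+-identityʳ j)) j≡nV)) done
  arrivals-tabulate (suc m) f j f≡ j+m≡nV = next (trans (f≡ fzero) (ℕₚ.+-identityʳ j))
    (arrivals-tabulate m (λ i → f (fsuc i)) (suc j) (λ i → trans (f≡ (fsuc i)) (ℕₚ.+-suc j (toℕ i)))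
                       (trans (sym (ℕₚ.+-suc j m)) j+m≡nV))

  allArrivals : Arrivals 0 (allFin nV)
  allArrivals = arrivals-tabulate nV (λ i → i) 0 (λ _ → refl) refl

  Unused : ℕ → Vec Bool nV → Set
  Unused j W = ∀ v → j ℕ.≤ toℕ v → lookup W v ≡ false

  unused-use : ∀ {j W v} → Unused j W → toℕ v ≡ j → Unused (suc j) (W [ v ]≔ true)
  unused-use {j} {W} {v} unused v≡j v′ j<v′ =
    trans (update-other W v v′ (λ e → ℕₚ.<-irrefl (trans (sym v≡j) e) j<v′)) (unused v′ (ℕₚ.≤-trans (ℕₚ.n≤1+n j) j<v′))

  unused-skip : ∀ {j W} → Unused j W → Unused (suc j) W
  unused-skip {j} unused v′ j<v′ = unused v′ (ℕₚ.≤-trans (ℕₚ.n≤1+n j) j<v′)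

  FreeRange : ℕ → ℕ → Matched nU → Set
  FreeRange a b M = ∀ i → a ℕ.≤ toℕ i → toℕ i ℕ.< b → lookup M i ≡ false

  freeRange-fill : ∀ {a b M u} → FreeRange a b M → toℕ u ≡ a → FreeRange (suc a) b (M [ u ]≔ true)
  freeRange-fill {a} {M = M} {u} free u≡a i a<i i<b =
    trans (update-other M u i (λ e → ℕₚ.<-irrefl (trans (sym u≡a) e) a<i)) (free i (ℕₚ.≤-trans (ℕₚ.n≤1+n a) a<i) i<b)

  freeRange-fillAbove : ∀ {a b M u} → FreeRange a b M → b ℕ.≤ toℕ u → FreeRange a b (M [ u ]≔ true)
  freeRange-fillAbove {b = b} {M} {u} free b≤u i a≤i i<b =
    trans (update-other M u i (λ e → ℕₚ.<-irrefl refl (ℕₚ.<-≤-trans i<b (subst (b ℕ.≤_) e b≤u)))) (free i a≤i i<b)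

module Analysis (n : ℕ) (0<n : 0 ℕ.< n) (p k c : ℚ) (0≤p : 0ℚ ≤ p) (p≤1 : p ≤ 1ℚ) (0≤c : 0ℚ ≤ c)
                (majorant : ∀ y → y ≤ k + c * (y * y)) where

  open HardInstance n 0<n p public
  open MajorantBounds p k c 0≤p p≤1 0≤c majorant
  open ≤-Reasoning

  nℚ : ℚ
  nℚ = ⌜ n ⌝

  -- the potentials with s of n slots filled and r early arrivals to come
  greedyPot optPot : ℕ → ℕ → ℚ
  greedyPot s r = upperPot p k c nℚ ⌜ s ⌝ ⌜ r ⌝
  optPot    s r = lowerPot p k c nℚ ⌜ s ⌝ ⌜ r ⌝

  drift-nonneg : ∀ {s} r → n ℕ.≤ s → 0ℚ ≤ drift p c nℚ ⌜ s ⌝ ⌜ r ⌝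
  drift-nonneg {s} r n≤s = 0≤* 0≤c (0≤* 0≤p (0≤+ (0≤+ (0≤+ (0≤+ 0≤1 gap) gap) rp) rp))
    where
      gap = ≤⇒0≤- (⌜⌝-mono n≤s)
      rp  = 0≤* (⌜⌝-nonneg r) 0≤p

  -- once all n slots are filled, further arrivals only add error
  greedyPot-grows : ∀ {s} r → n ℕ.≤ s → greedyPot s r ≤ greedyPot s (suc r)
  greedyPot-grows {s} r n≤s = ≤-fromGap _ (upperPot-drift p k c nℚ ⌜ s ⌝ ⌜ r ⌝) (drift-nonneg r n≤s)

  optPot-shrinks : ∀ {s} r → n ℕ.≤ s → optPot s (suc r) ≤ optPot s r
  optPot-shrinks {s} r n≤s = ≤-fromGap _ (lowerPot-drift p k c nℚ ⌜ s ⌝ ⌜ r ⌝) (drift-nonneg r n≤s)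

  -- after the early arrivals, probing a free good slot does not raise greedy's potential
  greedyPot-settle : ∀ {s} → s ℕ.< n → probeAvg p (greedyPot (suc s) 0) (greedyPot s 0) ≤ greedyPot s 0
  greedyPot-settle {s} s<n = ≤-fromGap _ (upperPot-settle p k c nℚ ⌜ s ⌝)
    (0≤* 0≤c (0≤* 0≤p (0≤+ (≤⇒0≤- (⌜⌝-mono s<n)) (≤⇒0≤- (⌜⌝-mono (ℕₚ.<⇒≤ s<n))))))

  L∸-early : ∀ {j} → j ℕ.< L → L ℕ.∸ j ≡ suc (L ℕ.∸ suc j)
  L∸-early j<L = ℕₚ.+-∸-assoc 1 j<L

  L∸-late : ∀ {j} → L ℕ.≤ j → L ℕ.∸ j ≡ 0
  L∸-late = ℕₚ.m≤n⇒m∸n≡0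

  greedy≤pot : ∀ vs j s M → Arrivals j vs → Prefix M s →
               greedyFrom I lowestFirst vs M ≤ greedyPot s (L ℕ.∸ j)
  greedy≤pot [] j s M done P =
    subst (λ r → 0ℚ ≤ greedyPot s r) (sym (L∸-late (ℕₚ.m≤m+n L L))) (upperPot-nonneg 0ℚ (nℚ - ⌜ s ⌝) ≤-refl)
  greedy≤pot (v ∷ vs) j s M (next v≡j arrivals) P with j ℕ.<? L | freeNbrs I v M in nbrs
  ... | yes j<L | [] = begin
    greedyFrom I lowestFirst vs M    ≤⟨ greedy≤pot vs (suc j) s M arrivals P ⟩
    greedyPot s (L ℕ.∸ suc j)        ≤⟨ greedyPot-grows (L ℕ.∸ suc j) (ℕₚ.≤-trans (ℕₚ.m≤m+n n n) full) ⟩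
    greedyPot s (suc (L ℕ.∸ suc j))  ≡⟨ cong (greedyPot s) (sym (L∸-early j<L)) ⟩
    greedyPot s (L ℕ.∸ j)            ∎
    where full = early-stuck⇒full {v} {M} (subst (ℕ._< L) (sym v≡j) j<L) nbrs P
  ... | no j≮L | [] = begin
    greedyFrom I lowestFirst vs M    ≤⟨ greedy≤pot vs (suc j) s M arrivals P ⟩
    greedyPot s (L ℕ.∸ suc j)        ≡⟨ cong (greedyPot s) (trans (L∸-late (ℕₚ.≤-trans (ℕₚ.≮⇒≥ j≮L) (ℕₚ.n≤1+n j)))
                                                                 (sym (L∸-late (ℕₚ.≮⇒≥ j≮L)))) ⟩
    greedyPot s (L ℕ.∸ j)            ∎
  ... | yes j<L | u ∷ _ = begin
    probeAvg p (greedyFrom I lowestFirst vs M′) (greedyFrom I lowestFirst vs M)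
      ≤⟨ probeAvg-mono 0≤p p≤1 (greedy≤pot vs (suc j) (suc s) M′ arrivals P′) (greedy≤pot vs (suc j) s M arrivals P) ⟩
    probeAvg p (greedyPot (suc s) (L ℕ.∸ suc j)) (greedyPot s (L ℕ.∸ suc j))
      ≡⟨ upperPot-harmonic p k c nℚ ⌜ s ⌝ ⌜ L ℕ.∸ suc j ⌝ ⟩
    greedyPot s (suc (L ℕ.∸ suc j))
      ≡⟨ cong (greedyPot s) (sym (L∸-early j<L)) ⟩
    greedyPot s (L ℕ.∸ j) ∎
    where
      M′ = M [ lowestFree v M ]≔ true
      P′ = prefix-extend {M} P (lowestFree-prefix {v} {M} P (subst (u ∈_) (sym nbrs) (here refl)))
  ... | no j≮L | u ∷ _ = begin
    probeAvg p (greedyFrom I lowestFirst vs M′) (greedyFrom I lowestFirst vs M)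
      ≤⟨ probeAvg-mono 0≤p p≤1 (after-early (suc s) (greedy≤pot vs (suc j) (suc s) M′ arrivals P′))
                                (after-early s (greedy≤pot vs (suc j) s M arrivals P)) ⟩
    probeAvg p (greedyPot (suc s) 0) (greedyPot s 0)
      ≤⟨ greedyPot-settle (late-probe⇒s<n {v} {M} (subst (λ z → ¬ (z ℕ.< L)) (sym v≡j) j≮L) u∈ P) ⟩
    greedyPot s 0
      ≡⟨ cong (greedyPot s) (sym (L∸-late (ℕₚ.≮⇒≥ j≮L))) ⟩
    greedyPot s (L ℕ.∸ j) ∎
    where
      u∈ = subst (u ∈_) (sym nbrs) (here refl)
      M′ = M [ lowestFree v M ]≔ true
      P′ = prefix-extend {M} P (lowestFree-prefix {v} {M} P u∈)
      after-early : ∀ s′ {x} → x ≤ greedyPot s′ (L ℕ.∸ suc j) → x ≤ greedyPot s′ 0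
      after-early s′ {x} = subst (λ r → x ≤ greedyPot s′ r) (L∸-late (ℕₚ.≤-trans (ℕₚ.≮⇒≥ j≮L) (ℕₚ.n≤1+n j)))

  greedyBound : greedyValue I lowestFirst ≤ greedyPot 0 L
  greedyBound = greedy≤pot (allFin nV) 0 0 (replicate nU false) allArrivals
    ((λ _ ()) , λ i _ → lookup-replicate i false)

  -- the values of OPT's possible first probes at online vertex v (none if v is used);
  -- optFrom I (suc fuel) M W is max0 of these over all v
  probeValues : ℕ → Matched nU → Vec Bool nV → Fin nV → List ℚ
  probeValues fuel M W v = if lookup W v then [] else
    map (λ u → probeAvg p (optFrom I fuel (M [ u ]≔ true) (W [ v ]≔ true)) (optFrom I fuel M (W [ v ]≔ true)))
        (freeNbrs I v M)

  opt-nonneg : ∀ fuel M W → 0ℚ ≤ optFrom I fuel M W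
  opt-nonneg zero       M W = ≤-refl
  opt-nonneg (suc fuel) M W = max0-nonneg (concatMap (probeValues fuel M W) (allFin nV))

  opt≥probe : ∀ fuel M W v u → lookup W v ≡ false → E v u ≡ true → lookup M u ≡ false →
    probeAvg p (optFrom I fuel (M [ u ]≔ true) (W [ v ]≔ true)) (optFrom I fuel M (W [ v ]≔ true))
      ≤ optFrom I (suc fuel) M W
  opt≥probe fuel M W v u unusedV e freeU =
    ≤max0 (∈-concatMap⁺ (probeValues fuel M W) (Any.map (λ { refl → chosen }) (∈-allFin v)))
    where
      value : Fin nU → ℚ
      value u = probeAvg p (optFrom I fuel (M [ u ]≔ true) (W [ v ]≔ true)) (optFrom I fuel M (W [ v ]≔ true))
      chosen : value u ∈ probeValues fuel M W v
      chosen = subst (λ b → value u ∈ (if b then [] else map value (freeNbrs I v M))) (sym unusedV)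
                     (∈-map⁺ value (edge⇒free {v} {M} e freeU))

  -- OPT's late policy: late arrival j probes good vertex b while b < n.
  opt≥late : ∀ r j fuel M W b → j ℕ.+ r ≡ nV → r ℕ.≤ fuel → Unused j W → FreeRange b n M → b ℕ.≤ n →
             optPot b r ≤ optFrom I fuel M W
  opt≥late zero j fuel M W b _ _ _ _ _ =
    ≤-trans (≤⇒-≤0 (errorTerm-dominates (nℚ - ⌜ b ⌝))) (opt-nonneg fuel M W)
  opt≥late (suc r) j (suc fuel) M W b j+r≡nV (s≤s r≤fuel) unused free b≤n with ℕₚ.m≤n⇒m<n∨m≡n b≤n
  ... | inj₁ b<n = begin
    optPot b (suc r)                                            ≡⟨ lowerPot-harmonic p k c nℚ ⌜ b ⌝ ⌜ r ⌝ ⟨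
    probeAvg p (optPot (suc b) r) (optPot b r)                  ≤⟨ probeAvg-mono 0≤p p≤1 IH-success IH-failure ⟩
    probeAvg p (optFrom I fuel M′ W′) (optFrom I fuel M W′)     ≤⟨ opt≥probe fuel M W v u unusedV (good-edge u<n) freeU ⟩
    optFrom I (suc fuel) M W                                    ∎
    where
      j′+r≡nV = trans (sym (ℕₚ.+-suc j r)) j+r≡nV
      j<nV = subst (j ℕ.<_) j+r≡nV (ℕₚ.m<m+n j (s≤s z≤n))
      v = fromℕ< j<nV
      v≡j = Finₚ.toℕ-fromℕ< j<nV
      b<nU = ℕₚ.≤-trans b<n (ℕₚ.m≤m+n n n)
      u = fromℕ< b<nU
      u≡b = Finₚ.toℕ-fromℕ< b<nU
      u<n = subst (ℕ._< n) (sym u≡b) b<n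
      unusedV = unused v (ℕₚ.≤-reflexive (sym v≡j))
      freeU = free u (ℕₚ.≤-reflexive (sym u≡b)) u<n
      M′ = M [ u ]≔ true
      W′ = W [ v ]≔ true
      IH-success = opt≥late r (suc j) fuel M′ W′ (suc b) j′+r≡nV r≤fuel (unused-use {j} {W} unused v≡j)
                            (freeRange-fill {M = M} free u≡b) b<n
      IH-failure = opt≥late r (suc j) fuel M W′ b j′+r≡nV r≤fuel (unused-use {j} {W} unused v≡j) free b≤n
  ... | inj₂ refl = ≤-trans (optPot-shrinks r ℕₚ.≤-refl)
    (opt≥late r (suc j) (suc fuel) M W n (trans (sym (ℕₚ.+-suc j r)) j+r≡nV) (ℕₚ.m≤n⇒m≤1+n r≤fuel)
              (unused-skip {j} {W} unused) free ℕₚ.≤-refl)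

  lateValue : ℚ
  lateValue = optPot 0 L

  -- OPT's early policy: early arrival j probes bad vertex n + a while a < n;
  -- afterwards the late policy collects lateValue.
  opt≥early : ∀ r j fuel M W a → j ℕ.+ r ≡ L → r ℕ.+ L ℕ.≤ fuel → Unused j W → FreeRange 0 n M →
              FreeRange (n ℕ.+ a) nU M → a ℕ.≤ n → optPot a r + lateValue ≤ optFrom I fuel M W
  opt≥early zero j fuel M W a j≡L L≤fuel unused good _ _ = begin
    optPot a 0 + lateValue  ≤⟨ +-monoˡ-≤ lateValue (≤⇒-≤0 (errorTerm-dominates (nℚ - ⌜ a ⌝))) ⟩
    0ℚ + lateValue          ≡⟨ +-identityˡ lateValue ⟩
    lateValue               ≤⟨ opt≥late L j fuel M W 0 (cong (ℕ._+ L) j≡L′) L≤fuel unused good z≤n ⟩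
    optFrom I fuel M W      ∎
    where j≡L′ = trans (sym (ℕₚ.+-identityʳ j)) j≡L
  opt≥early (suc r) j (suc fuel) M W a j+r≡L (s≤s r+L≤fuel) unused good bad a≤n with ℕₚ.m≤n⇒m<n∨m≡n a≤n
  ... | inj₁ a<n = begin
    optPot a (suc r) + lateValue
      ≡⟨ trans (probeAvg-shift p (optPot (suc a) r) (optPot a r) lateValue) (cong (_+ lateValue) (lowerPot-harmonic p k c nℚ ⌜ a ⌝ ⌜ r ⌝)) ⟨
    probeAvg p (optPot (suc a) r + lateValue) (optPot a r + lateValue)
      ≤⟨ probeAvg-mono 0≤p p≤1 IH-success IH-failure ⟩
    probeAvg p (optFrom I fuel M′ W′) (optFrom I fuel M W′)
      ≤⟨ opt≥probe fuel M W v u unusedV (early-edge v<L) freeU ⟩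
    optFrom I (suc fuel) M W ∎
    where
      j′+r≡L = trans (sym (ℕₚ.+-suc j r)) j+r≡L
      j<L = subst (j ℕ.<_) j+r≡L (ℕₚ.m<m+n j (s≤s z≤n))
      j<nV = ℕₚ.≤-trans j<L (ℕₚ.m≤m+n L L)
      v = fromℕ< j<nV
      v≡j = Finₚ.toℕ-fromℕ< j<nV
      v<L = subst (ℕ._< L) (sym v≡j) j<L
      n+a<nU = ℕₚ.+-monoʳ-< n a<n
      u = fromℕ< n+a<nU
      u≡n+a = Finₚ.toℕ-fromℕ< n+a<nU
      unusedV = unused v (ℕₚ.≤-reflexive (sym v≡j))
      freeU = bad u (ℕₚ.≤-reflexive (sym u≡n+a)) (Finₚ.toℕ<n u)
      M′ = M [ u ]≔ true
      W′ = W [ v ]≔ true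
      good′ = freeRange-fillAbove {M = M} good (subst (n ℕ.≤_) (sym u≡n+a) (ℕₚ.m≤m+n n a))
      bad′ = subst (λ z → FreeRange z nU M′) (sym (ℕₚ.+-suc n a)) (freeRange-fill {M = M} bad u≡n+a)
      IH-success = opt≥early r (suc j) fuel M′ W′ (suc a) j′+r≡L r+L≤fuel (unused-use {j} {W} unused v≡j) good′ bad′ a<n
      IH-failure = opt≥early r (suc j) fuel M W′ a j′+r≡L r+L≤fuel (unused-use {j} {W} unused v≡j) good bad a≤n
  ... | inj₂ refl = ≤-trans (+-monoˡ-≤ lateValue (optPot-shrinks r ℕₚ.≤-refl))
    (opt≥early r (suc j) (suc fuel) M W n (trans (sym (ℕₚ.+-suc j r)) j+r≡L) (ℕₚ.m≤n⇒m≤1+n r+L≤fuel)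
               (unused-skip {j} {W} unused) good bad ℕₚ.≤-refl)

  optBound : optPot 0 L + optPot 0 L ≤ optValue I
  optBound = opt≥early L 0 nV (replicate nU false) (replicate nV false) 0 refl ℕₚ.≤-refl
    (λ v _ → lookup-replicate v false) (λ i _ _ → lookup-replicate i false) (λ i _ _ → lookup-replicate i false) z≤n

module ParameterIdentities where
  open +-*-Solver

  -- errorTerm for p = w², k = x/2, c = w/2, R = x⁴, d = x², written as a
  -- polynomial in x, w and t = x·w
  errorPoly : (x w t : ℚ) → ℚ
  errorPoly x w t = x * ½ + (w * ½) * ((x * x) * (x * x)) * ((1ℚ - t * t) * (1ℚ - t * t))
                    + (x * ½) * (t * t * t) - (w * ½) * (t * t * t * t)

  errorTerm≡errorPoly : ∀ x w → errorTerm (w * w) (x * ½) (w * ½) ((x * x) * (x * x)) (x * x - 0ℚ) ≡ errorPoly x w (x * w)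
  errorTerm≡errorPoly = solve 2 (λ x w →
    let h = con ½ ; one = con 1ℚ ; t = x :* w ; p = w :* w ; R = (x :* x) :* (x :* x) ; d = x :* x :- con 0ℚ in
    x :* h :+ (w :* h) :* ((d :- R :* p) :* (d :- R :* p) :+ (R :* p) :* (one :- p))
    := x :* h :+ (w :* h) :* ((x :* x) :* (x :* x)) :* ((one :- t :* t) :* (one :- t :* t))
       :+ (x :* h) :* (t :* t :* t) :- (w :* h) :* (t :* t :* t :* t)) refl

  errorPoly-at-1 : ∀ x w → errorPoly x w 1ℚ ≡ x - w * ½
  errorPoly-at-1 = solve 2 (λ x w → let h = con ½ ; one = con 1ℚ in
    x :* h :+ (w :* h) :* ((x :* x) :* (x :* x)) :* ((one :- one :* one) :* (one :- one :* one))
    :+ (x :* h) :* (one :* one :* one) :- (w :* h) :* (one :* one :* one :* one)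
    := x :- w :* h) refl

  square-product : ∀ x w → (w * w) * (x * x) ≡ (x * w) * (x * w)
  square-product = solve 2 (λ x w → (w :* w) :* (x :* x) := (x :* w) :* (x :* w)) refl

  majorant-gap : ∀ x w t → (w * ½) * (((x * ½) + (w * ½) * (t * t)) - t) ≡
                 ((w * ½) * t - ½) * ((w * ½) * t - ½) + (x * w - 1ℚ) * (½ * ½)
  majorant-gap = solve 3 (λ x w t → let h = con ½ in
    (w :* h) :* (((x :* h) :+ (w :* h) :* (t :* t)) :- t)
    := ((w :* h) :* t :- h) :* ((w :* h) :* t :- h) :+ (x :* w :- con 1ℚ) :* (h :* h)) refl

  greedy-closedForm : ∀ x w → x * x + x ≡ ((x * x - 0ℚ) + (x - w * ½)) + w * ½
  greedy-closedForm = solve 2 (λ x w → x :* x :+ x := ((x :* x :- con 0ℚ) :+ (x :- w :* con ½)) :+ w :* con ½) refl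

  opt-closedForm : ∀ y w → let x = 1ℚ + y in
    ((x * x - 0ℚ) - (x - w * ½)) + ((x * x - 0ℚ) - (x - w * ½)) ≡ (x * y + x * y) + w
  opt-closedForm = solve 2 (λ y w → let x = con 1ℚ :+ y ; h = con ½ in
    ((x :* x :- con 0ℚ) :- (x :- w :* h)) :+ ((x :* x :- con 0ℚ) :- (x :- w :* h)) := (x :* y :+ x :* y) :+ w) refl

  ratio-closedForm : ∀ y ε w → let x = 1ℚ + y in
    (½ + ε) * ((x * y + x * y) + w) ≡ (x * x + x) + ((x + x) * (ε * y - 1ℚ) + (½ + ε) * w)
  ratio-closedForm = solve 3 (λ y ε w → let x = con 1ℚ :+ y ; h = con ½ in
    (h :+ ε) :* ((x :* y :+ x :* y) :+ w) := (x :* x :+ x) :+ ((x :+ x) :* (ε :* y :- con 1ℚ) :+ (h :+ ε) :* w)) refl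

open ParameterIdentities

ratio-bound : ∀ ε y w → 0ℚ < ε → 0ℚ ≤ y → 0ℚ ≤ w → 1ℚ ≤ ε * y →
  (1ℚ + y) * (1ℚ + y) + (1ℚ + y) ≤ (½ + ε) * (((1ℚ + y) * y + (1ℚ + y) * y) + w)
ratio-bound ε y w 0<ε 0≤y 0≤w εy≥1 = ≤-fromGap _ (ratio-closedForm y ε w)
  (0≤+ (0≤* (0≤+ 0≤x 0≤x) (≤⇒0≤- εy≥1)) (0≤* (0≤+ 0≤½ (<⇒≤ 0<ε)) 0≤w))
  where 0≤x = 0≤+ 0≤1 0≤y

-- The instance for parameter m: n = (m+1)², p = 1/n, and the majorant
-- y ≤ x/2 + y²/(2x) with x = m + 1 = √n.
module Construction (m : ℕ) where

  y x : ℚ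
  y = ⌜ m ⌝
  x = ⌜ suc m ⌝

  0<x : 0ℚ < x
  0<x = subst (_< x) (+-identityʳ 0ℚ) (+-mono-<-≤ (positive⁻¹ 1ℚ) (⌜⌝-nonneg m))

  instance
    x-positive : Positive x
    x-positive = positive 0<x

  w : ℚ
  w = (1/ x) {{pos⇒nonZero x}}

  w-positive : Positive w
  w-positive = 1/pos⇒pos x

  0≤w : 0ℚ ≤ w
  0≤w = <⇒≤ (positive⁻¹ w {{w-positive}})

  x*w≡1 : x * w ≡ 1ℚ
  x*w≡1 = *-inverseʳ x {{pos⇒nonZero x}}

  n : ℕ
  n = suc m ℕ.* suc m

  p k c : ℚ
  p = w * w
  k = x * ½
  c = w * ½

  ⌜n⌝≡x² : ⌜ n ⌝ ≡ x * x
  ⌜n⌝≡x² = ⌜⌝-* (suc m) (suc m)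

  p*n≡1 : p * ⌜ n ⌝ ≡ 1ℚ
  p*n≡1 = trans (cong (p *_) ⌜n⌝≡x²) (trans (square-product x w) (cong₂ _*_ x*w≡1 x*w≡1))

  0<p : 0ℚ < p
  0<p = positive⁻¹ p {{pos*pos⇒pos w {{w-positive}} w {{w-positive}}}}

  p≤1 : p ≤ 1ℚ
  p≤1 = subst₂ _≤_ (*-identityʳ p) p*n≡1 (*-monoˡ-≤-nonNeg p {{nonNegative (<⇒≤ 0<p)}} (⌜⌝-mono {1} {n} (s≤s z≤n)))

  majorant : ∀ t → t ≤ k + c * (t * t)
  majorant t = 0≤-⇒≤ (*-cancelˡ-≤-pos c {{pos*pos⇒pos w {{w-positive}} ½}}
    (subst₂ _≤_ (sym (*-zeroʳ c)) (sym (majorant-gap x w t)) (0≤+ (0≤square (c * t - ½)) xw-gap)))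
    where
      xw-gap : 0ℚ ≤ (x * w - 1ℚ) * (½ * ½)
      xw-gap = subst (λ z → 0ℚ ≤ (z - 1ℚ) * (½ * ½)) (sym x*w≡1) ≤-refl

  open Analysis n (s≤s z≤n) p k c (<⇒≤ 0<p) p≤1 (0≤* 0≤w 0≤½) majorant public

  errorTerm-value : errorTerm p k c ⌜ L ⌝ (⌜ n ⌝ - 0ℚ) ≡ x - w * ½
  errorTerm-value = begin
    errorTerm p k c ⌜ L ⌝ (⌜ n ⌝ - 0ℚ)                ≡⟨ cong₂ (λ R d → errorTerm p k c R (d - 0ℚ)) ⌜L⌝≡x⁴ ⌜n⌝≡x² ⟩
    errorTerm p k c ((x * x) * (x * x)) (x * x - 0ℚ)  ≡⟨ errorTerm≡errorPoly x w ⟩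
    errorPoly x w (x * w)                             ≡⟨ cong (errorPoly x w) x*w≡1 ⟩
    errorPoly x w 1ℚ                                  ≡⟨ errorPoly-at-1 x w ⟩
    x - w * ½                                         ∎
    where
      open ≡-Reasoning
      ⌜L⌝≡x⁴ = trans (⌜⌝-* n n) (cong₂ _*_ ⌜n⌝≡x² ⌜n⌝≡x²)

  greedy≤ : greedyValue I lowestFirst ≤ x * x + x
  greedy≤ = begin
    greedyValue I lowestFirst                            ≤⟨ greedyBound ⟩
    (⌜ n ⌝ - 0ℚ) + errorTerm p k c ⌜ L ⌝ (⌜ n ⌝ - 0ℚ)  ≡⟨ cong₂ (λ a e → (a - 0ℚ) + e) ⌜n⌝≡x² errorTerm-value ⟩
    (x * x - 0ℚ) + (x - w * ½)                           ≤⟨ ≤-fromGap (w * ½) (greedy-closedForm x w) (0≤* 0≤w 0≤½) ⟩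
    x * x + x                                            ∎
    where open ≤-Reasoning

  opt≥ : (x * y + x * y) + w ≤ optValue I
  opt≥ = subst (_≤ optValue I) (trans (cong₂ _+_ optPot-value optPot-value) (opt-closedForm y w)) optBound
    where
      optPot-value : optPot 0 L ≡ (x * x - 0ℚ) - (x - w * ½)
      optPot-value = cong₂ (λ a e → (a - 0ℚ) - e) ⌜n⌝≡x² errorTerm-value

  0<opt : 0ℚ < optValue I
  0<opt = <-≤-trans (subst (_< (x * y + x * y) + w) (+-identityˡ 0ℚ) (+-mono-≤-< 0≤2xy (positive⁻¹ w {{w-positive}}))) opt≥
    where 0≤2xy = 0≤+ (0≤* (<⇒≤ 0<x) (⌜⌝-nonneg m)) (0≤* (<⇒≤ 0<x) (⌜⌝-nonneg m))

  greedy≤ratio·opt : ∀ ε → 0ℚ < ε → 1ℚ ≤ ε * y → greedyValue I lowestFirst ≤ (½ + ε) * optValue I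
  greedy≤ratio·opt ε 0<ε εy≥1 = ≤-trans greedy≤ (≤-trans (ratio-bound ε y w 0<ε (⌜⌝-nonneg m) 0≤w εy≥1)
    (*-monoˡ-≤-nonNeg (½ + ε) {{nonNegative (0≤+ 0≤½ (<⇒≤ 0<ε))}} opt≥))

  m≤nU : m ℕ.≤ nU
  m≤nU = ℕₚ.≤-trans (ℕₚ.n≤1+n m) (ℕₚ.≤-trans (ℕₚ.m≤m*n (suc m) (suc m)) (ℕₚ.m≤m+n n n))

  p*nU≡2 : p * ℕtoℚ nU ≡ 1ℚ + 1ℚ
  p*nU≡2 = begin
    p * ℕtoℚ (n ℕ.+ n)      ≡⟨ cong (p *_) (trans (ℕtoℚ≡⌜⌝ (n ℕ.+ n)) (⌜⌝-+ n n)) ⟩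
    p * (⌜ n ⌝ + ⌜ n ⌝)     ≡⟨ *-distribˡ-+ p ⌜ n ⌝ ⌜ n ⌝ ⟩
    p * ⌜ n ⌝ + p * ⌜ n ⌝   ≡⟨ cong₂ _+_ p*n≡1 p*n≡1 ⟩
    1ℚ + 1ℚ                 ∎
    where open ≡-Reasoning

-- Theorem 8: with C = 2, for every ε > 0 and size bound N, the instance for
-- m = a + N (a from the Archimedean property, so ε·m ≥ 1) does the job.
theorem8 : Σ ℚ λ C → (ε : ℚ) → 0ℚ < ε → (N : ℕ) →
    Σ Instance λ I → Σ (TieBreak I) λ T →
      (Instance.nU I ≥ N) ×
      (0ℚ < Instance.p I) × (Instance.p I ≤ 1ℚ) × (Instance.p I * ℕtoℚ (Instance.nU I) ≤ C) ×
      (0ℚ < optValue I) ×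
      (greedyValue I T ≤ (½ + ε) * optValue I)
theorem8 = 1ℚ + 1ℚ , λ ε 0<ε N →
  let a , εa≥1 = archimedean ε 0<ε
      open Construction (a ℕ.+ N)
      εy≥1 = ≤-trans εa≥1 (*-monoˡ-≤-nonNeg ε {{nonNegative (<⇒≤ 0<ε)}} (⌜⌝-mono (ℕₚ.m≤m+n a N)))
  in I , lowestFirst , ℕₚ.≤-trans (ℕₚ.m≤n+m N a) m≤nU ,
     0<p , p≤1 , ≤-reflexive p*nU≡2 , 0<opt , greedy≤ratio·opt ε 0<ε εy≥1
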